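{- Let $A,B$ be tridendriform algebras over a field $\mathbb{K}$ with augmentations $\overline{A}=\mathbb{K}1\oplus A$, $\overline{B}=\mathbb{K}1\oplus B$, and let $A\overline{\otimes}B:=(A\otimes B)\oplus(\mathbb{K}1\otimes B)\oplus(A\otimes\mathbb{K}1)\subset\overline{A}\otimes\overline{B}$. For $\ltimes\in\{\prec,\cdot,\succ\}$ define bilinear products on $A\overline{\otimes}B$ on pure tensors $a\otimes b$, $c\otimes d$ (each of $a,c$ either $1$ or in $A$, each of $b,d$ either $1$ or in $B$, and neither tensor equal to $1\otimes 1$) by $(a\otimes b)\ltimes(c\otimes d)=(a*c)\otimes(b\ltimes d)$ if $b\in B$ or $d\in B$, and $(a\otimes 1)\ltimes(c\otimes 1)=(a\ltimes c)\otimes 1$ (here $a,c\in A$). Then $(A\overline{\otimes}B,\prec,\cdot,\succ)$ is a tridendriform algebra, and $*=\prec+\cdot+\succ$ on it is $(a\otimes b)*(c\otimes d)=(a*c)\otimes(b*d)$.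
   Context: A tridendriform algebra is a vector space with three bilinear products $\prec,\cdot,\succ$ such that, with $*=\prec+\cdot+\succ$, for all $a,b,c$: $(a\prec b)\prec c=a\prec(b*c)$; $(a\succ b)\prec c=a\succ(b\prec c)$; $(a*b)\succ c=a\succ(b\succ c)$; $(a\succ b)\cdot c=a\succ(b\cdot c)$; $(a\prec b)\cdot c=a\cdot(b\succ c)$; $(a\cdot b)\prec c=a\cdot(b\prec c)$; $(a\cdot b)\cdot c=a\cdot(b\cdot c)$. The augmented tridendriform algebra $\overline{A}=\mathbb{K}1\oplus A$ of a tridendriform algebra $A$ is obtained by adjoining a unit $1$ for $*$ (with $1*1=1$) and setting, for all $a\in A$: $1\prec a=0$, $a\prec 1=a$, $1\succ a=a$, $a\succ 1=0$, $a\cdot 1=1\cdot a=0$; the products $1\prec1$, $1\cdot 1$, $1\succ 1$ are left undefined. In the definition above, $b\ltimes d$ and $a*c$ are computed in $\overline{B}$ and $\overline{A}$ with these conventions. -}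

module Defs where

open import Level using (Level; _⊔_; suc)
open import Algebra.Bundles using (CommutativeRing)
open import Algebra.Core using (Op₂; Op₁)
open import Algebra.Module.Bundles using (Module)
open import Data.Maybe using (Maybe; just; nothing)
open import Data.Product using (∃)
open import Relation.Binary.Core using (Rel)
open import Relation.Nullary using (¬_)

record Field (k ℓ : Level) : Set (suc (k ⊔ ℓ)) where
  field
    commutativeRing : CommutativeRing k ℓ
  open CommutativeRing commutativeRing public
  field
    0≉1     : ¬ (0# ≈ 1#)
    inverse : ∀ x → ¬ (x ≈ 0#) → ∃ λ y → (x * y) ≈ 1#

module _ {k ℓk m ℓm : Level} (R : CommutativeRing k ℓk) {M : Set m}
         (_≈_ : Rel M ℓm) (_+_ : Op₂ M)
         (_•_ : CommutativeRing.Carrier R → M → M) where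

  record IsBilinear (_∘_ : Op₂ M) : Set (k ⊔ m ⊔ ℓm) where
    field
      cong      : ∀ {x x′ y y′} → x ≈ x′ → y ≈ y′ → (x ∘ y) ≈ (x′ ∘ y′)
      distribʳ  : ∀ x y z → ((x + y) ∘ z) ≈ ((x ∘ z) + (y ∘ z))
      distribˡ  : ∀ x y z → (x ∘ (y + z)) ≈ ((x ∘ y) + (x ∘ z))
      scalarˡ   : ∀ λ′ x y → ((λ′ • x) ∘ y) ≈ (λ′ • (x ∘ y))
      scalarʳ   : ∀ λ′ x y → (x ∘ (λ′ • y)) ≈ (λ′ • (x ∘ y))

  record IsTridendriform (_≺_ _·_ _≻_ : Op₂ M) : Set (k ⊔ m ⊔ ℓm) where
    _*_ : Op₂ M
    x * y = ((x ≺ y) + (x · y)) + (x ≻ y)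
    field
      ≺-bilinear : IsBilinear _≺_
      ·-bilinear : IsBilinear _·_
      ≻-bilinear : IsBilinear _≻_
      ax1 : ∀ a b c → ((a ≺ b) ≺ c) ≈ (a ≺ (b * c))
      ax2 : ∀ a b c → ((a ≻ b) ≺ c) ≈ (a ≻ (b ≺ c))
      ax3 : ∀ a b c → ((a * b) ≻ c) ≈ (a ≻ (b ≻ c))
      ax4 : ∀ a b c → ((a ≻ b) · c) ≈ (a ≻ (b · c))
      ax5 : ∀ a b c → ((a ≺ b) · c) ≈ (a · (b ≻ c))
      ax6 : ∀ a b c → ((a · b) ≺ c) ≈ (a · (b ≺ c))
      ax7 : ∀ a b c → ((a · b) · c) ≈ (a · (b · c))

record TridendriformAlgebra {k ℓk : Level} (R : CommutativeRing k ℓk) (m ℓm : Level)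
       : Set (k ⊔ ℓk ⊔ suc (m ⊔ ℓm)) where
  field
    module′ : Module R m ℓm
  open Module module′ public
  field
    _≺_ _·_ _≻_ : Op₂ Carrierᴹ
    isTridendriform : IsTridendriform R _≈ᴹ_ _+ᴹ_ _*ₗ_ _≺_ _·_ _≻_
  open IsTridendriform isTridendriform public using (_*_)

data Op3 : Set where
  ≺op ·op ≻op : Op3

-- The space A ⊗̄ B = (A⊗B) ⊕ (𝕂1⊗B) ⊕ (A⊗𝕂1), constructed as the free
-- 𝕂-vector space on pure tensors modulo the vector-space laws and the
-- (bi)linearity relations of the three summands (setoid quotient).

module TensorConstruction {k ℓk a ℓa b ℓb : Level} (K : Field k ℓk)
  (A : TridendriformAlgebra (Field.commutativeRing K) a ℓa)
  (B : TridendriformAlgebra (Field.commutativeRing K) b ℓb) where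

  R : CommutativeRing k ℓk
  R = Field.commutativeRing K

  open CommutativeRing R using () renaming (Carrier to 𝕂)
  module K = CommutativeRing R
  module A = TridendriformAlgebra A
  module B = TridendriformAlgebra B

  data PT : Set (a ⊔ b) where
    _⊗_ : A.Carrierᴹ → B.Carrierᴹ → PT
    1⊗_ : B.Carrierᴹ → PT
    _⊗1 : A.Carrierᴹ → PT

  infixl 6 _+T_
  infixr 7 _•T_
  data Term : Set (k ⊔ a ⊔ b) where
    gen  : PT → Term
    0T   : Term
    _+T_ : Term → Term → Term
    -T_  : Term → Term
    _•T_ : 𝕂 → Term → Term

  infix 4 _≃_
  data _≃_ : Term → Term → Set (k ⊔ ℓk ⊔ a ⊔ ℓa ⊔ b ⊔ ℓb) where
    ≃-refl  : ∀ {s} → s ≃ s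
    ≃-sym   : ∀ {s t} → s ≃ t → t ≃ s
    ≃-trans : ∀ {s t u} → s ≃ t → t ≃ u → s ≃ u
    +-cong  : ∀ {s s′ t t′} → s ≃ s′ → t ≃ t′ → s +T t ≃ s′ +T t′
    neg-cong : ∀ {s s′} → s ≃ s′ → -T s ≃ -T s′
    •-cong  : ∀ {x y s s′} → x K.≈ y → s ≃ s′ → x •T s ≃ y •T s′
    +-assoc : ∀ s t u → (s +T t) +T u ≃ s +T (t +T u)
    +-comm  : ∀ s t → s +T t ≃ t +T s
    +-idˡ   : ∀ s → 0T +T s ≃ s
    +-invˡ  : ∀ s → (-T s) +T s ≃ 0T
    •-distrib-+T : ∀ x s t → x •T (s +T t) ≃ x •T s +T x •T t
    •-distrib-+K : ∀ x y s → (x K.+ y) •T s ≃ x •T s +T y •T s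
    •-assoc : ∀ x y s → (x K.* y) •T s ≃ x •T (y •T s)
    •-id    : ∀ s → K.1# •T s ≃ s
    ⊗-cong  : ∀ {x x′ y y′} → x A.≈ᴹ x′ → y B.≈ᴹ y′ → gen (x ⊗ y) ≃ gen (x′ ⊗ y′)
    1⊗-cong : ∀ {y y′} → y B.≈ᴹ y′ → gen (1⊗ y) ≃ gen (1⊗ y′)
    ⊗1-cong : ∀ {x x′} → x A.≈ᴹ x′ → gen (x ⊗1) ≃ gen (x′ ⊗1)
    ⊗-+ˡ : ∀ x x′ y → gen ((x A.+ᴹ x′) ⊗ y) ≃ gen (x ⊗ y) +T gen (x′ ⊗ y)
    ⊗-+ʳ : ∀ x y y′ → gen (x ⊗ (y B.+ᴹ y′)) ≃ gen (x ⊗ y) +T gen (x ⊗ y′)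
    ⊗-•ˡ : ∀ λ′ x y → gen ((λ′ A.*ₗ x) ⊗ y) ≃ λ′ •T gen (x ⊗ y)
    ⊗-•ʳ : ∀ λ′ x y → gen (x ⊗ (λ′ B.*ₗ y)) ≃ λ′ •T gen (x ⊗ y)
    1⊗-+ : ∀ y y′ → gen (1⊗ (y B.+ᴹ y′)) ≃ gen (1⊗ y) +T gen (1⊗ y′)
    1⊗-• : ∀ λ′ y → gen (1⊗ (λ′ B.*ₗ y)) ≃ λ′ •T gen (1⊗ y)
    ⊗1-+ : ∀ x x′ → gen ((x A.+ᴹ x′) ⊗1) ≃ gen (x ⊗1) +T gen (x′ ⊗1)
    ⊗1-• : ∀ λ′ x → gen ((λ′ A.*ₗ x) ⊗1) ≃ λ′ •T gen (x ⊗1)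

  _•ᵣT_ : Term → 𝕂 → Term
  s •ᵣT x = x •T s

  -- Elements of Ā = 𝕂1 ⊕ A of the form "1 or an element of A" are
  -- represented by Maybe A (nothing = 1); similarly for B̄.

  opA : Op3 → Op₂ A.Carrierᴹ
  opA ≺op = A._≺_
  opA ·op = A._·_
  opA ≻op = A._≻_

  opB : Op3 → Op₂ B.Carrierᴹ
  opB ≺op = B._≺_
  opB ·op = B._·_
  opB ≻op = B._≻_

  starĀ : Maybe A.Carrierᴹ → Maybe A.Carrierᴹ → Maybe A.Carrierᴹ
  starĀ nothing  nothing  = nothing
  starĀ nothing  (just c) = just c
  starĀ (just x) nothing  = just x
  starĀ (just x) (just c) = just (x A.* c)

  starB̄ : Maybe B.Carrierᴹ → Maybe B.Carrierᴹ → Maybe B.Carrierᴹ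
  starB̄ nothing  nothing  = nothing
  starB̄ nothing  (just d) = just d
  starB̄ (just y) nothing  = just y
  starB̄ (just y) (just d) = just (y B.* d)

  -- b ⋉ d in B̄ for b, d ∈ {1} ∪ B, not both 1, with the augmentation
  -- conventions 1≺d = 0, b≺1 = b, 1≻d = d, b≻1 = 0, b·1 = 1·d = 0.
  -- (The value for b = d = 1 is undefined in the paper; it is never
  -- used below and is set to 0 only for totality.)
  augB : Op3 → Maybe B.Carrierᴹ → Maybe B.Carrierᴹ → B.Carrierᴹ
  augB o  (just y) (just d) = opB o y d
  augB ≺op (just y) nothing = y
  augB ·op (just y) nothing = B.0ᴹ
  augB ≻op (just y) nothing = B.0ᴹ
  augB ≺op nothing (just d) = B.0ᴹ
  augB ·op nothing (just d) = B.0ᴹ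
  augB ≻op nothing (just d) = d
  augB o  nothing nothing   = B.0ᴹ

  fstPT : PT → Maybe A.Carrierᴹ
  fstPT (x ⊗ y) = just x
  fstPT (1⊗ y)  = nothing
  fstPT (x ⊗1)  = just x

  sndPT : PT → Maybe B.Carrierᴹ
  sndPT (x ⊗ y) = just y
  sndPT (1⊗ y)  = just y
  sndPT (x ⊗1)  = nothing

  tensorB : Maybe A.Carrierᴹ → B.Carrierᴹ → Term
  tensorB nothing  y = gen (1⊗ y)
  tensorB (just x) y = gen (x ⊗ y)

  -- u ⊗ v for u ∈ {1} ∪ A, v ∈ {1} ∪ B, (u, v) ≠ (1, 1)
  -- (the value at (1, 1) is never used; it is 0 only for totality)
  tensor : Maybe A.Carrierᴹ → Maybe B.Carrierᴹ → Term
  tensor u        (just y) = tensorB u y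
  tensor (just x) nothing  = gen (x ⊗1)
  tensor nothing  nothing  = 0T

  ptProd : Op3 → PT → PT → Term
  ptProd o (x ⊗1) (c ⊗1) = gen (opA o x c ⊗1)
  ptProd o p q = tensorB (starĀ (fstPT p) (fstPT q)) (augB o (sndPT p) (sndPT q))

  mulGen : Op3 → PT → Term → Term
  mulGen o p (gen q)  = ptProd o p q
  mulGen o p 0T       = 0T
  mulGen o p (t +T u) = mulGen o p t +T mulGen o p u
  mulGen o p (-T t)   = -T (mulGen o p t)
  mulGen o p (x •T t) = x •T mulGen o p t

  mulT : Op3 → Term → Term → Term
  mulT o (gen p)  t = mulGen o p t
  mulT o 0T       t = 0T
  mulT o (s +T u) t = mulT o s t +T mulT o u t
  mulT o (-T s)   t = -T (mulT o s t)
  mulT o (x •T s) t = x •T mulT o s t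

  _≺T_ _·T_ _≻T_ _*T_ : Term → Term → Term
  s ≺T t = mulT ≺op s t
  s ·T t = mulT ·op s t
  s ≻T t = mulT ≻op s t
  s *T t = ((s ≺T t) +T (s ·T t)) +T (s ≻T t)

-- Everything is reduced to pure tensors. A map on pure tensors that is linear in each
-- tensor factor descends to the quotient A ⊗̄ B, so both products, defined on pure tensors
-- and extended linearly, are well defined and bilinear; and two trilinear maps agreeing on
-- pure tensors agree everywhere. Each tridendriform axiom is thus checked on triples of pure
-- tensors, in eight cases according to which factors lie in A ⊗ 𝕂1. When none does, it is
-- the corresponding axiom of B together with associativity of * on Ā (itself the sum of the
-- axioms of A); when all do, it is the axiom of A; in the mixed cases the augmentation
-- conventions b ≺ 1 = b, 1 ≻ d = d, 1 ≺ d = b ≻ 1 = b · 1 = 1 · d = 0 leave terms that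
-- vanish or agree by associativity of * and linearity. Adding the three products of two
-- pure tensors gives the formula for *.

module Submission where

open import Level using (Level; _⊔_)
open import Algebra.Bundles using (CommutativeRing; CommutativeMonoid; AbelianGroup)
open import Algebra.Core using (Op₂)
open import Algebra.Module.Bundles using (Module)
open import Algebra.Module.Structures using (IsModule)
open import Algebra.Module.Structures.Biased using (module IsModuleFromLeft)
open import Data.Maybe using (Maybe; just; nothing)
open import Data.Maybe.Relation.Binary.Pointwise as Pointwise using (Pointwise; just; nothing)
open import Data.Product using (_×_; _,_)
open import Function using (id; _∘_)
open import Relation.Binary.Bundles using (Setoid)
open import Relation.Binary.Core using (Rel)
open import Relation.Binary.PropositionalEquality as ≡ using (_≡_)
import Algebra.Consequences.Setoid as SetoidConsequences
import Algebra.Properties.AbelianGroup as AbelianGroupProperties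
import Algebra.Properties.CommutativeSemigroup as CommutativeSemigroupProperties
import Algebra.Solver.CommutativeMonoid as CommutativeMonoidSolver
import Relation.Binary.Reasoning.Setoid as SetoidReasoning

open import Defs

module _ {k ℓk : Level} {R : CommutativeRing k ℓk} where
  open CommutativeRing R using (0#; *-comm)

  module _ {m ℓm n ℓn : Level} (M : Module R m ℓm) (N : Module R n ℓn) where
    private
      module M = Module M
      module N = Module N

    record IsLinearMap (f : M.Carrierᴹ → N.Carrierᴹ) : Set (k ⊔ m ⊔ ℓm ⊔ ℓn) where
      field
        cong    : ∀ {x y} → x M.≈ᴹ y → f x N.≈ᴹ f y
        +ᴹ-homo : ∀ x y → f (x M.+ᴹ y) N.≈ᴹ f x N.+ᴹ f y
        *ₗ-homo : ∀ c x → f (c M.*ₗ x) N.≈ᴹ c N.*ₗ f x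

      open SetoidReasoning N.≈ᴹ-setoid

      0ᴹ-homo : f M.0ᴹ N.≈ᴹ N.0ᴹ
      0ᴹ-homo = begin
        f M.0ᴹ             ≈⟨ cong (M.*ₗ-zeroˡ M.0ᴹ) ⟨
        f (0# M.*ₗ M.0ᴹ)   ≈⟨ *ₗ-homo 0# M.0ᴹ ⟩
        0# N.*ₗ f M.0ᴹ     ≈⟨ N.*ₗ-zeroˡ _ ⟩
        N.0ᴹ               ∎

      -ᴹ-homo : ∀ x → f (M.-ᴹ x) N.≈ᴹ N.-ᴹ f x
      -ᴹ-homo x = inverseʳ-unique (f x) (f (M.-ᴹ x)) (begin
        f x N.+ᴹ f (M.-ᴹ x)   ≈⟨ +ᴹ-homo x (M.-ᴹ x) ⟨
        f (x M.+ᴹ M.-ᴹ x)     ≈⟨ cong (M.-ᴹ‿inverseʳ x) ⟩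
        f M.0ᴹ                ≈⟨ 0ᴹ-homo ⟩
        N.0ᴹ                  ∎)
        where open AbelianGroupProperties N.+ᴹ-abelianGroup using (inverseʳ-unique)

      +ᴹ-homo³ : ∀ x y z → f ((x M.+ᴹ y) M.+ᴹ z) N.≈ᴹ (f x N.+ᴹ f y) N.+ᴹ f z
      +ᴹ-homo³ x y z = N.≈ᴹ-trans (+ᴹ-homo _ z) (N.+ᴹ-congʳ (+ᴹ-homo x y))

  module _ {m ℓm : Level} {M : Module R m ℓm} where
    open Module M

    id-linear : IsLinearMap M M id
    id-linear = record { cong = id ; +ᴹ-homo = λ _ _ → ≈ᴹ-refl ; *ₗ-homo = λ _ _ → ≈ᴹ-refl }

    *ₗ-linear : ∀ c → IsLinearMap M M (c *ₗ_)
    *ₗ-linear c = record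
      { cong    = *ₗ-congˡ
      ; +ᴹ-homo = *ₗ-distribˡ c
      ; *ₗ-homo = λ d x → ≈ᴹ-trans (≈ᴹ-sym (*ₗ-assoc c d x))
                            (≈ᴹ-trans (*ₗ-congʳ (*-comm c d)) (*ₗ-assoc d c x))
      }

    module _ {n ℓn : Level} {N : Module R n ℓn} where
      private module N = Module N

      const-0ᴹ-linear : IsLinearMap N M (λ _ → 0ᴹ)
      const-0ᴹ-linear = record
        { cong    = λ _ → ≈ᴹ-refl
        ; +ᴹ-homo = λ _ _ → ≈ᴹ-sym (+ᴹ-identityˡ 0ᴹ)
        ; *ₗ-homo = λ c _ → ≈ᴹ-sym (*ₗ-zeroʳ c)
        }

      ∘-linear : ∀ {p ℓp} {P : Module R p ℓp} {g : N.Carrierᴹ → Module.Carrierᴹ P}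
                   {f : Carrierᴹ → N.Carrierᴹ} →
                 IsLinearMap N P g → IsLinearMap M N f → IsLinearMap M P (g ∘ f)
      ∘-linear {P = P} {g} {f} g-linear f-linear = record
        { cong    = G.cong ∘ F.cong
        ; +ᴹ-homo = λ x y → P.≈ᴹ-trans (G.cong (F.+ᴹ-homo x y)) (G.+ᴹ-homo _ _)
        ; *ₗ-homo = λ c x → P.≈ᴹ-trans (G.cong (F.*ₗ-homo c x)) (G.*ₗ-homo c _)
        }
        where
        module P = Module P
        module G = IsLinearMap g-linear
        module F = IsLinearMap f-linear

  module ModuleLemmas {m ℓm : Level} (M : Module R m ℓm) where
    open Module M

    Bilinear : Op₂ Carrierᴹ → Set (k ⊔ m ⊔ ℓm)
    Bilinear = IsBilinear R _≈ᴹ_ _+ᴹ_ _*ₗ_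

    module _ {_∘_ : Op₂ Carrierᴹ} (∘-bilinear : Bilinear _∘_) where
      open IsBilinear ∘-bilinear

      linearˡ : ∀ y → IsLinearMap M M (_∘ y)
      linearˡ y = record
        { cong = λ e → cong e ≈ᴹ-refl ; +ᴹ-homo = λ x x′ → distribʳ x x′ y ; *ₗ-homo = λ c x → scalarˡ c x y }

      linearʳ : ∀ x → IsLinearMap M M (x ∘_)
      linearʳ x = record
        { cong = cong ≈ᴹ-refl ; +ᴹ-homo = distribˡ x ; *ₗ-homo = λ c y → scalarʳ c x y }

    +-bilinear : ∀ {_∘_ _⋆_ : Op₂ Carrierᴹ} → Bilinear _∘_ → Bilinear _⋆_ →
                 Bilinear (λ x y → (x ∘ y) +ᴹ (x ⋆ y))
    +-bilinear ∘-bilinear ⋆-bilinear = record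
      { cong     = λ e f → +ᴹ-cong (∘.cong e f) (⋆.cong e f)
      ; distribʳ = λ x y z → ≈ᴹ-trans (+ᴹ-cong (∘.distribʳ x y z) (⋆.distribʳ x y z)) (interchange _ _ _ _)
      ; distribˡ = λ x y z → ≈ᴹ-trans (+ᴹ-cong (∘.distribˡ x y z) (⋆.distribˡ x y z)) (interchange _ _ _ _)
      ; scalarˡ  = λ c x y →
          ≈ᴹ-trans (+ᴹ-cong (∘.scalarˡ c x y) (⋆.scalarˡ c x y)) (≈ᴹ-sym (*ₗ-distribˡ c _ _))
      ; scalarʳ  = λ c x y →
          ≈ᴹ-trans (+ᴹ-cong (∘.scalarʳ c x y) (⋆.scalarʳ c x y)) (≈ᴹ-sym (*ₗ-distribˡ c _ _))
      }
      where
      module ∘ = IsBilinear ∘-bilinear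
      module ⋆ = IsBilinear ⋆-bilinear
      open CommutativeSemigroupProperties (CommutativeMonoid.commutativeSemigroup +ᴹ-commutativeMonoid)
        using (interchange)

    record IsTrilinear (F : Carrierᴹ → Carrierᴹ → Carrierᴹ → Carrierᴹ) : Set (k ⊔ m ⊔ ℓm) where
      field
        linear₁ : ∀ y z → IsLinearMap M M (λ x → F x y z)
        linear₂ : ∀ x z → IsLinearMap M M (λ y → F x y z)
        linear₃ : ∀ x y → IsLinearMap M M (λ z → F x y z)

    module _ {_∘_ _⋆_ : Op₂ Carrierᴹ} (∘-bilinear : Bilinear _∘_) (⋆-bilinear : Bilinear _⋆_) where

      nestedˡ-trilinear : IsTrilinear (λ x y z → (x ∘ y) ⋆ z)
      nestedˡ-trilinear = record
        { linear₁ = λ y z → ∘-linear (linearˡ ⋆-bilinear z) (linearˡ ∘-bilinear y)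
        ; linear₂ = λ x z → ∘-linear (linearˡ ⋆-bilinear z) (linearʳ ∘-bilinear x)
        ; linear₃ = λ x y → linearʳ ⋆-bilinear (x ∘ y)
        }

      nestedʳ-trilinear : IsTrilinear (λ x y z → x ∘ (y ⋆ z))
      nestedʳ-trilinear = record
        { linear₁ = λ y z → linearˡ ∘-bilinear (y ⋆ z)
        ; linear₂ = λ x z → ∘-linear (linearʳ ∘-bilinear x) (linearˡ ⋆-bilinear z)
        ; linear₃ = λ x y → ∘-linear (linearʳ ∘-bilinear x) (linearʳ ⋆-bilinear y)
        }

    bilinear-resp-≈ : ∀ {_∘_ _⋆_ : Op₂ Carrierᴹ} → (∀ x y → (x ∘ y) ≈ᴹ (x ⋆ y)) →
                      Bilinear _∘_ → Bilinear _⋆_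
    bilinear-resp-≈ {_∘_} {_⋆_} ∘≈⋆ ∘-bilinear = record
      { cong     = λ e e′ → transport (cong e e′) (∘≈⋆ _ _)
      ; distribʳ = λ x y z → transport (distribʳ x y z) (+ᴹ-cong (∘≈⋆ _ _) (∘≈⋆ _ _))
      ; distribˡ = λ x y z → transport (distribˡ x y z) (+ᴹ-cong (∘≈⋆ _ _) (∘≈⋆ _ _))
      ; scalarˡ  = λ c x y → transport (scalarˡ c x y) (*ₗ-congˡ (∘≈⋆ _ _))
      ; scalarʳ  = λ c x y → transport (scalarʳ c x y) (*ₗ-congˡ (∘≈⋆ _ _))
      }
      where
      open IsBilinear ∘-bilinear
      transport : ∀ {x y u v} → (x ∘ y) ≈ᴹ u → u ≈ᴹ v → (x ⋆ y) ≈ᴹ v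
      transport e e′ = ≈ᴹ-trans (≈ᴹ-sym (∘≈⋆ _ _)) (≈ᴹ-trans e e′)

    +ᴹ-zerosʳ : ∀ {x z z′} → z ≈ᴹ 0ᴹ → z′ ≈ᴹ 0ᴹ → (x +ᴹ z) +ᴹ z′ ≈ᴹ x
    +ᴹ-zerosʳ e e′ = ≈ᴹ-trans (+ᴹ-cong (+ᴹ-congˡ e) e′) (≈ᴹ-trans (+ᴹ-identityʳ _) (+ᴹ-identityʳ _))

    +ᴹ-zerosˡ : ∀ {x z z′} → z ≈ᴹ 0ᴹ → z′ ≈ᴹ 0ᴹ → (z +ᴹ z′) +ᴹ x ≈ᴹ x
    +ᴹ-zerosˡ e e′ = ≈ᴹ-trans (+ᴹ-congʳ (≈ᴹ-trans (+ᴹ-cong e e′) (+ᴹ-identityˡ 0ᴹ))) (+ᴹ-identityˡ _)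

module TridendriformAlgebraProperties {k ℓk m ℓm : Level} {R : CommutativeRing k ℓk}
  (T : TridendriformAlgebra R m ℓm) where
  open TridendriformAlgebra T
  open IsTridendriform isTridendriform
    using (≺-bilinear; ·-bilinear; ≻-bilinear; ax1; ax2; ax3; ax4; ax5; ax6; ax7)
  open ModuleLemmas module′

  *-bilinear : Bilinear _*_
  *-bilinear = +-bilinear (+-bilinear ≺-bilinear ·-bilinear) ≻-bilinear

  *-assoc : ∀ a b c → (a * b) * c ≈ᴹ a * (b * c)
  *-assoc a b c = begin
    (a * b) * c
      ≈⟨ +ᴹ-cong (+ᴹ-cong
           (≈ᴹ-trans (+ᴹ-homo³ (linearˡ ≺-bilinear c) _ _ _)
                     (+ᴹ-cong (+ᴹ-cong (ax1 a b c) (ax6 a b c)) (ax2 a b c)))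
           (≈ᴹ-trans (+ᴹ-homo³ (linearˡ ·-bilinear c) _ _ _)
                     (+ᴹ-cong (+ᴹ-cong (ax5 a b c) (ax7 a b c)) (ax4 a b c))))
           (ax3 a b c) ⟩
    (((p₁ +ᴹ p₂) +ᴹ p₃) +ᴹ ((p₄ +ᴹ p₅) +ᴹ p₆)) +ᴹ p₇
      ≈⟨ solve 7 (λ x₁ x₂ x₃ x₄ x₅ x₆ x₇ →
                   (((x₁ ⊕ x₂) ⊕ x₃) ⊕ ((x₄ ⊕ x₅) ⊕ x₆)) ⊕ x₇ ⊜ (x₁ ⊕ ((x₂ ⊕ x₅) ⊕ x₄)) ⊕ ((x₃ ⊕ x₆) ⊕ x₇))
                 ≈ᴹ-refl p₁ p₂ p₃ p₄ p₅ p₆ p₇ ⟩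
    (p₁ +ᴹ ((p₂ +ᴹ p₅) +ᴹ p₄)) +ᴹ ((p₃ +ᴹ p₆) +ᴹ p₇)
      ≈⟨ +ᴹ-cong (+ᴹ-congˡ (+ᴹ-homo³ (linearʳ ·-bilinear a) _ _ _)) (+ᴹ-homo³ (linearʳ ≻-bilinear a) _ _ _) ⟨
    a * (b * c) ∎
    where
    open SetoidReasoning ≈ᴹ-setoid
    open CommutativeMonoidSolver +ᴹ-commutativeMonoid using (solve; _⊕_; _⊜_)
    open IsLinearMap using (+ᴹ-homo³)
    p₁ p₂ p₃ p₄ p₅ p₆ p₇ : Carrierᴹ
    p₁ = a ≺ (b * c) ; p₂ = a · (b ≺ c) ; p₃ = a ≻ (b ≺ c) ; p₄ = a · (b ≻ c)
    p₅ = a · (b · c) ; p₆ = a ≻ (b · c) ; p₇ = a ≻ (b ≻ c)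

module TensorProperties {k ℓk a ℓa b ℓb : Level} (𝔽 : Field k ℓk)
  (𝒜 : TridendriformAlgebra (Field.commutativeRing 𝔽) a ℓa)
  (ℬ : TridendriformAlgebra (Field.commutativeRing 𝔽) b ℓb) where

  open TensorConstruction 𝔽 𝒜 ℬ
  private
    module Aₚ = TridendriformAlgebraProperties 𝒜
    module Aᴹ = ModuleLemmas A.module′
    module Bᴹ = ModuleLemmas B.module′
    module Aᵗ = IsTridendriform A.isTridendriform
    module Bᵗ = IsTridendriform B.isTridendriform

  ≃-setoid : Setoid (k ⊔ a ⊔ b) (k ⊔ ℓk ⊔ a ⊔ ℓa ⊔ b ⊔ ℓb)
  ≃-setoid = record { Carrier = Term ; _≈_ = _≃_
    ; isEquivalence = record { refl = ≃-refl ; sym = ≃-sym ; trans = ≃-trans } }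

  +T-abelianGroup : AbelianGroup (k ⊔ a ⊔ b) (k ⊔ ℓk ⊔ a ⊔ ℓa ⊔ b ⊔ ℓb)
  +T-abelianGroup = record
    { Carrier = Term ; _≈_ = _≃_ ; _∙_ = _+T_ ; ε = 0T ; _⁻¹ = -T_
    ; isAbelianGroup = record
      { isGroup = record
        { isMonoid = record
          { isSemigroup = record
            { isMagma = record { isEquivalence = Setoid.isEquivalence ≃-setoid ; ∙-cong = +-cong }
            ; assoc = +-assoc }
          ; identity = +-idˡ , comm∧idˡ⇒idʳ +-comm +-idˡ }
        ; inverse = +-invˡ , comm∧invˡ⇒invʳ +-comm +-invˡ
        ; ⁻¹-cong = neg-cong }
      ; comm = +-comm } }
    where open SetoidConsequences ≃-setoid using (comm∧idˡ⇒idʳ; comm∧invˡ⇒invʳ)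

  open AbelianGroupProperties +T-abelianGroup using (identityʳ-unique; ⁻¹-∙-comm)
  open CommutativeSemigroupProperties (AbelianGroup.commutativeSemigroup +T-abelianGroup)
    using (interchange)

  •-zeroˡ : ∀ s → K.0# •T s ≃ 0T
  •-zeroˡ s = identityʳ-unique (K.0# •T s) (K.0# •T s)
    (≃-trans (≃-sym (•-distrib-+K _ _ s)) (•-cong (K.+-identityˡ K.0#) ≃-refl))

  •-zeroʳ : ∀ c → c •T 0T ≃ 0T
  •-zeroʳ c = identityʳ-unique (c •T 0T) (c •T 0T)
    (≃-trans (≃-sym (•-distrib-+T c 0T 0T)) (•-cong K.refl (+-idˡ 0T)))

  isModule : IsModule R _≃_ _+T_ 0T -T_ _•T_ _•ᵣT_
  isModule = IsModuleFromLeft.isModule {commutativeRing = R} (record { isLeftModule = record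
    { isLeftSemimodule = record
      { +ᴹ-isCommutativeMonoid = AbelianGroup.isCommutativeMonoid +T-abelianGroup
      ; isPreleftSemimodule = record
        { *ₗ-cong = •-cong ; *ₗ-zeroˡ = •-zeroˡ ; *ₗ-distribʳ = λ s x y → •-distrib-+K x y s
        ; *ₗ-identityˡ = •-id ; *ₗ-assoc = •-assoc ; *ₗ-zeroʳ = •-zeroʳ ; *ₗ-distribˡ = •-distrib-+T } }
    ; -ᴹ‿cong = neg-cong
    ; -ᴹ‿inverse = AbelianGroup.inverse +T-abelianGroup } })

  termModule : Module R (k ⊔ a ⊔ b) (k ⊔ ℓk ⊔ a ⊔ ℓa ⊔ b ⊔ ℓb)
  termModule = record { isModule = isModule }

  private
    module Tᴹ = ModuleLemmas termModule

  •T-linear : ∀ c → IsLinearMap termModule termModule (c •T_)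
  •T-linear = *ₗ-linear

  infix 4 _≈Ā_
  _≈Ā_ : Rel (Maybe A.Carrierᴹ) (a ⊔ ℓa)
  _≈Ā_ = Pointwise A._≈ᴹ_

  ≈Ā-refl : ∀ {u} → u ≈Ā u
  ≈Ā-refl = Pointwise.refl A.≈ᴹ-refl

  ≈Ā-sym : ∀ {u v} → u ≈Ā v → v ≈Ā u
  ≈Ā-sym = Pointwise.sym A.≈ᴹ-sym

  starĀ-assoc : ∀ u v w → starĀ (starĀ u v) w ≈Ā starĀ u (starĀ v w)
  starĀ-assoc nothing  nothing  nothing  = nothing
  starĀ-assoc nothing  nothing  (just z) = ≈Ā-refl
  starĀ-assoc nothing  (just y) nothing  = ≈Ā-refl
  starĀ-assoc nothing  (just y) (just z) = ≈Ā-refl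
  starĀ-assoc (just x) nothing  nothing  = ≈Ā-refl
  starĀ-assoc (just x) nothing  (just z) = ≈Ā-refl
  starĀ-assoc (just x) (just y) nothing  = ≈Ā-refl
  starĀ-assoc (just x) (just y) (just z) = just (Aₚ.*-assoc x y z)

  opA-bilinear : ∀ o → Aᴹ.Bilinear (opA o)
  opA-bilinear ≺op = Aᵗ.≺-bilinear
  opA-bilinear ·op = Aᵗ.·-bilinear
  opA-bilinear ≻op = Aᵗ.≻-bilinear

  opB-bilinear : ∀ o → Bᴹ.Bilinear (opB o)
  opB-bilinear ≺op = Bᵗ.≺-bilinear
  opB-bilinear ·op = Bᵗ.·-bilinear
  opB-bilinear ≻op = Bᵗ.≻-bilinear

  opB-zeroˡ : ∀ o w → opB o B.0ᴹ w B.≈ᴹ B.0ᴹ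
  opB-zeroˡ o w = IsLinearMap.0ᴹ-homo (Bᴹ.linearˡ (opB-bilinear o) w)

  opB-zeroʳ : ∀ o w → opB o w B.0ᴹ B.≈ᴹ B.0ᴹ
  opB-zeroʳ o w = IsLinearMap.0ᴹ-homo (Bᴹ.linearʳ (opB-bilinear o) w)

  augB-linearʳ : ∀ o β → IsLinearMap B.module′ B.module′ (λ w → augB o β (just w))
  augB-linearʳ o   (just y) = Bᴹ.linearʳ (opB-bilinear o) y
  augB-linearʳ ≺op nothing  = const-0ᴹ-linear
  augB-linearʳ ·op nothing  = const-0ᴹ-linear
  augB-linearʳ ≻op nothing  = id-linear

  augB-linearˡ : ∀ o δ → IsLinearMap B.module′ B.module′ (λ w → augB o (just w) δ)
  augB-linearˡ o   (just d) = Bᴹ.linearˡ (opB-bilinear o) d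
  augB-linearˡ ≺op nothing  = id-linear
  augB-linearˡ ·op nothing  = const-0ᴹ-linear
  augB-linearˡ ≻op nothing  = const-0ᴹ-linear

  -- Pure tensors u ⊗ w with u ∈ Ā and w ∈ B are kept in one constructor, so that
  -- a ⊗ b and 1 ⊗ b are treated together.
  data Pure : Set (a ⊔ b) where
    [_⊗_] : Maybe A.Carrierᴹ → B.Carrierᴹ → Pure
    [_⊗1] : A.Carrierᴹ → Pure

  toPT : Pure → PT
  toPT [ nothing ⊗ w ] = 1⊗ w
  toPT [ just x ⊗ w ]  = x ⊗ w
  toPT [ x ⊗1]         = x ⊗1

  pure : PT → Pure
  pure (x ⊗ y) = [ just x ⊗ y ]
  pure (1⊗ y)  = [ nothing ⊗ y ]
  pure (x ⊗1)  = [ x ⊗1]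

  pure-toPT : ∀ P → pure (toPT P) ≡ P
  pure-toPT [ nothing ⊗ w ] = ≡.refl
  pure-toPT [ just x ⊗ w ]  = ≡.refl
  pure-toPT [ x ⊗1]         = ≡.refl

  ⟦_⟧ : Pure → Term
  ⟦ P ⟧ = gen (toPT P)

  fstᴾ : Pure → Maybe A.Carrierᴹ
  fstᴾ [ u ⊗ w ] = u
  fstᴾ [ x ⊗1]   = just x

  sndᴾ : Pure → Maybe B.Carrierᴹ
  sndᴾ [ u ⊗ w ] = just w
  sndᴾ [ x ⊗1]   = nothing

  mulPure : Op3 → Pure → Pure → Pure
  mulPure o [ x ⊗1] [ c ⊗1] = [ opA o x c ⊗1]
  mulPure o P       Q       = [ starĀ (fstᴾ P) (fstᴾ Q) ⊗ augB o (sndᴾ P) (sndᴾ Q) ]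

  infixl 7 _≺ᴾ_ _·ᴾ_ _≻ᴾ_
  _≺ᴾ_ _·ᴾ_ _≻ᴾ_ : Pure → Pure → Pure
  _≺ᴾ_ = mulPure ≺op
  _·ᴾ_ = mulPure ·op
  _≻ᴾ_ = mulPure ≻op

  ptProd-pure : ∀ o p q → ptProd o p q ≡ ⟦ mulPure o (pure p) (pure q) ⟧
  ptProd-pure o (x ⊗ y) (c ⊗ d) = ≡.refl
  ptProd-pure o (x ⊗ y) (1⊗ d)  = ≡.refl
  ptProd-pure o (x ⊗ y) (c ⊗1)  = ≡.refl
  ptProd-pure o (1⊗ y)  (c ⊗ d) = ≡.refl
  ptProd-pure o (1⊗ y)  (1⊗ d)  = ≡.refl
  ptProd-pure o (1⊗ y)  (c ⊗1)  = ≡.refl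
  ptProd-pure o (x ⊗1)  (c ⊗ d) = ≡.refl
  ptProd-pure o (x ⊗1)  (1⊗ d)  = ≡.refl
  ptProd-pure o (x ⊗1)  (c ⊗1)  = ≡.refl

  record IsBilinearOnPure (f : Pure → Term) : Set (k ⊔ ℓk ⊔ a ⊔ ℓa ⊔ b ⊔ ℓb) where
    field
      ⊗-linearʳ : ∀ u → IsLinearMap B.module′ termModule (λ w → f [ u ⊗ w ])
      ⊗-linearˡ : ∀ w → IsLinearMap A.module′ termModule (λ x → f [ just x ⊗ w ])
      ⊗1-linear : IsLinearMap A.module′ termModule (λ x → f [ x ⊗1])

    [⊗]-cong : ∀ {u u′ w w′} → u ≈Ā u′ → w B.≈ᴹ w′ → f [ u ⊗ w ] ≃ f [ u′ ⊗ w′ ]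
    [⊗]-cong nothing  e = IsLinearMap.cong (⊗-linearʳ nothing) e
    [⊗]-cong (just d) e = ≃-trans (IsLinearMap.cong (⊗-linearˡ _) d) (IsLinearMap.cong (⊗-linearʳ _) e)

    [⊗]-zero : ∀ {u w} → w B.≈ᴹ B.0ᴹ → f [ u ⊗ w ] ≃ 0T
    [⊗]-zero {u} e = ≃-trans (IsLinearMap.cong (⊗-linearʳ u) e) (IsLinearMap.0ᴹ-homo (⊗-linearʳ u))

  ⟦⟧-bilinearOnPure : IsBilinearOnPure ⟦_⟧
  ⟦⟧-bilinearOnPure = record
    { ⊗-linearʳ = linearʳ
    ; ⊗-linearˡ = λ w → record
        { cong = λ e → ⊗-cong e B.≈ᴹ-refl ; +ᴹ-homo = λ x x′ → ⊗-+ˡ x x′ w ; *ₗ-homo = λ c x → ⊗-•ˡ c x w }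
    ; ⊗1-linear = record { cong = ⊗1-cong ; +ᴹ-homo = ⊗1-+ ; *ₗ-homo = ⊗1-• }
    }
    where
    linearʳ : ∀ u → IsLinearMap B.module′ termModule (λ w → ⟦ [ u ⊗ w ] ⟧)
    linearʳ nothing  = record { cong = 1⊗-cong ; +ᴹ-homo = 1⊗-+ ; *ₗ-homo = 1⊗-• }
    linearʳ (just x) = record { cong = ⊗-cong A.≈ᴹ-refl ; +ᴹ-homo = ⊗-+ʳ x ; *ₗ-homo = λ c → ⊗-•ʳ c x }

  module ⟦⟧ = IsBilinearOnPure ⟦⟧-bilinearOnPure

  ⟦starĀ⊗⟧-linearʳ : ∀ v w → IsLinearMap A.module′ termModule (λ x → ⟦ [ starĀ v (just x) ⊗ w ] ⟧)
  ⟦starĀ⊗⟧-linearʳ nothing  w = ⟦⟧.⊗-linearˡ w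
  ⟦starĀ⊗⟧-linearʳ (just y) w = ∘-linear (⟦⟧.⊗-linearˡ w) (Aᴹ.linearʳ Aₚ.*-bilinear y)

  ⟦starĀ⊗⟧-linearˡ : ∀ v w → IsLinearMap A.module′ termModule (λ x → ⟦ [ starĀ (just x) v ⊗ w ] ⟧)
  ⟦starĀ⊗⟧-linearˡ nothing  w = ⟦⟧.⊗-linearˡ w
  ⟦starĀ⊗⟧-linearˡ (just y) w = ∘-linear (⟦⟧.⊗-linearˡ w) (Aᴹ.linearˡ Aₚ.*-bilinear y)

  mulPure-bilinearOnPureʳ : ∀ o P → IsBilinearOnPure (λ Q → ⟦ mulPure o P Q ⟧)
  mulPure-bilinearOnPureʳ o [ v ⊗ y ] = record
    { ⊗-linearʳ = λ u → ∘-linear (⟦⟧.⊗-linearʳ (starĀ v u)) (augB-linearʳ o (just y))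
    ; ⊗-linearˡ = λ w → ⟦starĀ⊗⟧-linearʳ v (opB o y w)
    ; ⊗1-linear = ⟦starĀ⊗⟧-linearʳ v (augB o (just y) nothing)
    }
  mulPure-bilinearOnPureʳ o [ x ⊗1] = record
    { ⊗-linearʳ = λ u → ∘-linear (⟦⟧.⊗-linearʳ (starĀ (just x) u)) (augB-linearʳ o nothing)
    ; ⊗-linearˡ = λ w → ⟦starĀ⊗⟧-linearʳ (just x) (augB o nothing (just w))
    ; ⊗1-linear = ∘-linear ⟦⟧.⊗1-linear (Aᴹ.linearʳ (opA-bilinear o) x)
    }

  mulPure-bilinearOnPureˡ : ∀ o Q → IsBilinearOnPure (λ P → ⟦ mulPure o P Q ⟧)
  mulPure-bilinearOnPureˡ o Q = record
    { ⊗-linearʳ = λ u → ∘-linear (⟦⟧.⊗-linearʳ (starĀ u (fstᴾ Q))) (augB-linearˡ o (sndᴾ Q))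
    ; ⊗-linearˡ = λ w → ⟦starĀ⊗⟧-linearˡ (fstᴾ Q) (augB o (just w) (sndᴾ Q))
    ; ⊗1-linear = ⊗1-linear Q
    }
    where
    ⊗1-linear : ∀ Q → IsLinearMap A.module′ termModule (λ x → ⟦ mulPure o [ x ⊗1] Q ⟧)
    ⊗1-linear [ v ⊗ y ] = ⟦starĀ⊗⟧-linearˡ v (augB o nothing (just y))
    ⊗1-linear [ c ⊗1]   = ∘-linear ⟦⟧.⊗1-linear (Aᴹ.linearˡ (opA-bilinear o) c)

  extend : (Pure → Term) → Term → Term
  extend f (gen p)  = f (pure p)
  extend f 0T       = 0T
  extend f (s +T t) = extend f s +T extend f t
  extend f (-T s)   = -T extend f s
  extend f (c •T s) = c •T extend f s

  extend-≗ : ∀ {f g} → (∀ P → f P ≃ g P) → ∀ t → extend f t ≃ extend g t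
  extend-≗ h (gen p)  = h (pure p)
  extend-≗ h 0T       = ≃-refl
  extend-≗ h (s +T t) = +-cong (extend-≗ h s) (extend-≗ h t)
  extend-≗ h (-T s)   = neg-cong (extend-≗ h s)
  extend-≗ h (c •T s) = •-cong K.refl (extend-≗ h s)

  extend-+ : ∀ {f g h} → (∀ P → f P ≃ g P +T h P) → ∀ t → extend f t ≃ extend g t +T extend h t
  extend-+ e (gen p)  = e (pure p)
  extend-+ e 0T       = ≃-sym (+-idˡ 0T)
  extend-+ e (s +T t) = ≃-trans (+-cong (extend-+ e s) (extend-+ e t)) (interchange _ _ _ _)
  extend-+ e (-T s)   = ≃-trans (neg-cong (extend-+ e s)) (≃-sym (⁻¹-∙-comm _ _))
  extend-+ e (c •T s) = ≃-trans (•-cong K.refl (extend-+ e s)) (•-distrib-+T _ _ _)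

  extend-• : ∀ {f g} c → (∀ P → f P ≃ c •T g P) → ∀ t → extend f t ≃ c •T extend g t
  extend-• c e (gen p)  = e (pure p)
  extend-• c e 0T       = ≃-sym (•-zeroʳ c)
  extend-• c e (s +T t) = ≃-trans (+-cong (extend-• c e s) (extend-• c e t)) (≃-sym (•-distrib-+T _ _ _))
  extend-• c e (-T s)   = ≃-trans (neg-cong (extend-• c e s)) (≃-sym (IsLinearMap.-ᴹ-homo (•T-linear c) _))
  extend-• c e (d •T s) = ≃-trans (•-cong K.refl (extend-• c e s)) (≃-sym (IsLinearMap.*ₗ-homo (•T-linear c) d _))

  module _ {f} (f-bilinear : IsBilinearOnPure f) where
    open IsBilinearOnPure f-bilinear
    open IsLinearMap using (cong; +ᴹ-homo; *ₗ-homo)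

    extend-cong : ∀ {s t} → s ≃ t → extend f s ≃ extend f t
    extend-cong ≃-refl                = ≃-refl
    extend-cong (≃-sym e)             = ≃-sym (extend-cong e)
    extend-cong (≃-trans e e′)        = ≃-trans (extend-cong e) (extend-cong e′)
    extend-cong (+-cong e e′)         = +-cong (extend-cong e) (extend-cong e′)
    extend-cong (neg-cong e)          = neg-cong (extend-cong e)
    extend-cong (•-cong d e)          = •-cong d (extend-cong e)
    extend-cong (+-assoc s t u)       = +-assoc _ _ _
    extend-cong (+-comm s t)          = +-comm _ _
    extend-cong (+-idˡ s)             = +-idˡ _
    extend-cong (+-invˡ s)            = +-invˡ _
    extend-cong (•-distrib-+T c s t)  = •-distrib-+T _ _ _
    extend-cong (•-distrib-+K c c′ s) = •-distrib-+K _ _ _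
    extend-cong (•-assoc c c′ s)      = •-assoc _ _ _
    extend-cong (•-id s)              = •-id _
    extend-cong (⊗-cong d e)          = [⊗]-cong (just d) e
    extend-cong (1⊗-cong e)           = [⊗]-cong nothing e
    extend-cong (⊗1-cong d)           = cong ⊗1-linear d
    extend-cong (⊗-+ˡ x x′ y)         = +ᴹ-homo (⊗-linearˡ y) x x′
    extend-cong (⊗-+ʳ x y y′)         = +ᴹ-homo (⊗-linearʳ (just x)) y y′
    extend-cong (⊗-•ˡ c x y)          = *ₗ-homo (⊗-linearˡ y) c x
    extend-cong (⊗-•ʳ c x y)          = *ₗ-homo (⊗-linearʳ (just x)) c y
    extend-cong (1⊗-+ y y′)           = +ᴹ-homo (⊗-linearʳ nothing) y y′
    extend-cong (1⊗-• c y)            = *ₗ-homo (⊗-linearʳ nothing) c y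
    extend-cong (⊗1-+ x x′)           = +ᴹ-homo ⊗1-linear x x′
    extend-cong (⊗1-• c x)            = *ₗ-homo ⊗1-linear c x

  extend-linear : ∀ {m ℓm} {M : Module R m ℓm} {F : Module.Carrierᴹ M → Pure → Term} →
                  (∀ Q → IsLinearMap M termModule (λ x → F x Q)) →
                  ∀ t → IsLinearMap M termModule (λ x → extend (F x) t)
  extend-linear F-linear t = record
    { cong    = λ e → extend-≗ (λ Q → IsLinearMap.cong (F-linear Q) e) t
    ; +ᴹ-homo = λ x y → extend-+ (λ Q → IsLinearMap.+ᴹ-homo (F-linear Q) x y) t
    ; *ₗ-homo = λ c x → extend-• c (λ Q → IsLinearMap.*ₗ-homo (F-linear Q) c x) t
    }

  extend-bilinearOnPure : ∀ {F : Pure → Pure → Term} →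
                          (∀ Q → IsBilinearOnPure (λ P → F P Q)) →
                          ∀ t → IsBilinearOnPure (λ P → extend (F P) t)
  extend-bilinearOnPure F-bil t = record
    { ⊗-linearʳ = λ u → extend-linear (λ Q → IsBilinearOnPure.⊗-linearʳ (F-bil Q) u) t
    ; ⊗-linearˡ = λ w → extend-linear (λ Q → IsBilinearOnPure.⊗-linearˡ (F-bil Q) w) t
    ; ⊗1-linear = extend-linear (λ Q → IsBilinearOnPure.⊗1-linear (F-bil Q)) t
    }

  module _ {f} (f-linear : IsLinearMap termModule termModule f) where
    open IsLinearMap f-linear

    linear-extend : ∀ t → f t ≃ extend (f ∘ ⟦_⟧) t
    linear-extend (gen (x ⊗ y)) = ≃-refl
    linear-extend (gen (1⊗ y))  = ≃-refl
    linear-extend (gen (x ⊗1))  = ≃-refl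
    linear-extend 0T            = 0ᴹ-homo
    linear-extend (s +T t)      = ≃-trans (+ᴹ-homo s t) (+-cong (linear-extend s) (linear-extend t))
    linear-extend (-T s)        = ≃-trans (-ᴹ-homo s) (neg-cong (linear-extend s))
    linear-extend (c •T s)      = ≃-trans (*ₗ-homo c s) (•-cong K.refl (linear-extend s))

  linear-ext : ∀ {f g} → IsLinearMap termModule termModule f → IsLinearMap termModule termModule g →
               (∀ P → f ⟦ P ⟧ ≃ g ⟦ P ⟧) → ∀ t → f t ≃ g t
  linear-ext f-linear g-linear h t =
    ≃-trans (linear-extend f-linear t) (≃-trans (extend-≗ h t) (≃-sym (linear-extend g-linear t)))

  trilinear-ext : ∀ {F H} → Tᴹ.IsTrilinear F → Tᴹ.IsTrilinear H →
                  (∀ P Q R → F ⟦ P ⟧ ⟦ Q ⟧ ⟦ R ⟧ ≃ H ⟦ P ⟧ ⟦ Q ⟧ ⟦ R ⟧) →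
                  ∀ x y z → F x y z ≃ H x y z
  trilinear-ext F-trilinear H-trilinear h x y z =
    linear-ext (F.linear₁ y z) (H.linear₁ y z) (λ P →
      linear-ext (F.linear₂ ⟦ P ⟧ z) (H.linear₂ ⟦ P ⟧ z) (λ Q →
        linear-ext (F.linear₃ ⟦ P ⟧ ⟦ Q ⟧) (H.linear₃ ⟦ P ⟧ ⟦ Q ⟧) (h P Q) z) y) x
    where
    module F = Tᴹ.IsTrilinear F-trilinear
    module H = Tᴹ.IsTrilinear H-trilinear

  mulGen-extend : ∀ o p t → mulGen o p t ≡ extend (λ Q → ⟦ mulPure o (pure p) Q ⟧) t
  mulGen-extend o p (gen q)  = ptProd-pure o p q
  mulGen-extend o p 0T       = ≡.refl
  mulGen-extend o p (s +T t) = ≡.cong₂ _+T_ (mulGen-extend o p s) (mulGen-extend o p t)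
  mulGen-extend o p (-T s)   = ≡.cong -T_ (mulGen-extend o p s)
  mulGen-extend o p (c •T s) = ≡.cong (c •T_) (mulGen-extend o p s)

  mulT-extend : ∀ o s t → mulT o s t ≡ extend (λ P → extend (λ Q → ⟦ mulPure o P Q ⟧) t) s
  mulT-extend o (gen p)  t = mulGen-extend o p t
  mulT-extend o 0T       t = ≡.refl
  mulT-extend o (s +T u) t = ≡.cong₂ _+T_ (mulT-extend o s t) (mulT-extend o u t)
  mulT-extend o (-T s)   t = ≡.cong -T_ (mulT-extend o s t)
  mulT-extend o (c •T s) t = ≡.cong (c •T_) (mulT-extend o s t)

  mulT-bilinear : ∀ o → Tᴹ.Bilinear (mulT o)
  mulT-bilinear o = Tᴹ.bilinear-resp-≈ (λ s t → ≃-sym (Setoid.reflexive ≃-setoid (mulT-extend o s t))) (record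
    { cong     = λ {_} {s′} {t} e e′ →
        ≃-trans (extend-cong (extend-bilinearOnPure (mulPure-bilinearOnPureˡ o) t) e)
                (extend-≗ (λ P → extend-cong (mulPure-bilinearOnPureʳ o P) e′) s′)
    ; distribʳ = λ _ _ _ → ≃-refl
    ; distribˡ = λ s _ _ → extend-+ (λ _ → ≃-refl) s
    ; scalarˡ  = λ _ _ _ → ≃-refl
    ; scalarʳ  = λ c s _ → extend-• c (λ _ → ≃-refl) s
    })

  *T-bilinear : Tᴹ.Bilinear _*T_
  *T-bilinear = Tᴹ.+-bilinear (Tᴹ.+-bilinear (mulT-bilinear ≺op) (mulT-bilinear ·op)) (mulT-bilinear ≻op)

  mulT-⟦⟧ : ∀ o P Q → mulT o ⟦ P ⟧ ⟦ Q ⟧ ≡ ⟦ mulPure o P Q ⟧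
  mulT-⟦⟧ o P Q = ≡.trans (mulT-extend o ⟦ P ⟧ ⟦ Q ⟧)
    (≡.cong₂ (λ P′ Q′ → ⟦ mulPure o P′ Q′ ⟧) (pure-toPT P) (pure-toPT Q))

  mulT-⟦⟧-nestedˡ : ∀ o o′ P Q R → mulT o (mulT o′ ⟦ P ⟧ ⟦ Q ⟧) ⟦ R ⟧ ≡ ⟦ mulPure o (mulPure o′ P Q) R ⟧
  mulT-⟦⟧-nestedˡ o o′ P Q R = ≡.trans (≡.cong (λ s → mulT o s ⟦ R ⟧) (mulT-⟦⟧ o′ P Q)) (mulT-⟦⟧ o _ R)

  mulT-⟦⟧-nestedʳ : ∀ o o′ P Q R → mulT o ⟦ P ⟧ (mulT o′ ⟦ Q ⟧ ⟦ R ⟧) ≡ ⟦ mulPure o P (mulPure o′ Q R) ⟧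
  mulT-⟦⟧-nestedʳ o o′ P Q R = ≡.trans (≡.cong (mulT o ⟦ P ⟧) (mulT-⟦⟧ o′ Q R)) (mulT-⟦⟧ o P _)

  mulT-⟦⟧-*ˡ : ∀ o P Q R → mulT o (⟦ P ⟧ *T ⟦ Q ⟧) ⟦ R ⟧ ≡
               (⟦ mulPure o (P ≺ᴾ Q) R ⟧ +T ⟦ mulPure o (P ·ᴾ Q) R ⟧) +T ⟦ mulPure o (P ≻ᴾ Q) R ⟧
  mulT-⟦⟧-*ˡ o P Q R = ≡.cong₂ _+T_
    (≡.cong₂ _+T_ (mulT-⟦⟧-nestedˡ o ≺op P Q R) (mulT-⟦⟧-nestedˡ o ·op P Q R)) (mulT-⟦⟧-nestedˡ o ≻op P Q R)

  mulT-⟦⟧-*ʳ : ∀ o P Q R → mulT o ⟦ P ⟧ (⟦ Q ⟧ *T ⟦ R ⟧) ≡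
               (⟦ mulPure o P (Q ≺ᴾ R) ⟧ +T ⟦ mulPure o P (Q ·ᴾ R) ⟧) +T ⟦ mulPure o P (Q ≻ᴾ R) ⟧
  mulT-⟦⟧-*ʳ o P Q R = ≡.cong₂ _+T_
    (≡.cong₂ _+T_ (mulT-⟦⟧-nestedʳ o ≺op P Q R) (mulT-⟦⟧-nestedʳ o ·op P Q R)) (mulT-⟦⟧-nestedʳ o ≻op P Q R)

  open IsLinearMap using (+ᴹ-homo³)

  [⊗]-sum³ : ∀ u w₁ w₂ w₃ →
             ⟦ [ u ⊗ (w₁ B.+ᴹ w₂) B.+ᴹ w₃ ] ⟧ ≃ (⟦ [ u ⊗ w₁ ] ⟧ +T ⟦ [ u ⊗ w₂ ] ⟧) +T ⟦ [ u ⊗ w₃ ] ⟧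
  [⊗]-sum³ u = +ᴹ-homo³ (⟦⟧.⊗-linearʳ u)

  [⊗]-cong-sum³ : ∀ {u u′ w w₁ w₂ w₃} → u ≈Ā u′ → w B.≈ᴹ (w₁ B.+ᴹ w₂) B.+ᴹ w₃ →
                  ⟦ [ u ⊗ w ] ⟧ ≃ (⟦ [ u′ ⊗ w₁ ] ⟧ +T ⟦ [ u′ ⊗ w₂ ] ⟧) +T ⟦ [ u′ ⊗ w₃ ] ⟧
  [⊗]-cong-sum³ {u′ = u′} d e = ≃-trans (⟦⟧.[⊗]-cong d e) ([⊗]-sum³ u′ _ _ _)

  [starĀ⊗]-cong-sum³ʳ : ∀ {u} v x₁ x₂ x₃ w → u ≈Ā starĀ v (just ((x₁ A.+ᴹ x₂) A.+ᴹ x₃)) →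
                        ⟦ [ u ⊗ w ] ⟧ ≃ (⟦ [ starĀ v (just x₁) ⊗ w ] ⟧ +T ⟦ [ starĀ v (just x₂) ⊗ w ] ⟧)
                                        +T ⟦ [ starĀ v (just x₃) ⊗ w ] ⟧
  [starĀ⊗]-cong-sum³ʳ v x₁ x₂ x₃ w d =
    ≃-trans (⟦⟧.[⊗]-cong d B.≈ᴹ-refl) (+ᴹ-homo³ (⟦starĀ⊗⟧-linearʳ v w) x₁ x₂ x₃)

  [starĀ⊗]-cong-sum³ˡ : ∀ {u} v x₁ x₂ x₃ w → u ≈Ā starĀ (just ((x₁ A.+ᴹ x₂) A.+ᴹ x₃)) v →
                        ⟦ [ u ⊗ w ] ⟧ ≃ (⟦ [ starĀ (just x₁) v ⊗ w ] ⟧ +T ⟦ [ starĀ (just x₂) v ⊗ w ] ⟧)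
                                        +T ⟦ [ starĀ (just x₃) v ⊗ w ] ⟧
  [starĀ⊗]-cong-sum³ˡ v x₁ x₂ x₃ w d =
    ≃-trans (⟦⟧.[⊗]-cong d B.≈ᴹ-refl) (+ᴹ-homo³ (⟦starĀ⊗⟧-linearˡ v w) x₁ x₂ x₃)

  [⊗1]-cong-sum³ : ∀ {x x₁ x₂ x₃} → x A.≈ᴹ (x₁ A.+ᴹ x₂) A.+ᴹ x₃ →
                   ⟦ [ x ⊗1] ⟧ ≃ (⟦ [ x₁ ⊗1] ⟧ +T ⟦ [ x₂ ⊗1] ⟧) +T ⟦ [ x₃ ⊗1] ⟧
  [⊗1]-cong-sum³ e = ≃-trans (IsLinearMap.cong ⟦⟧.⊗1-linear e) (+ᴹ-homo³ ⟦⟧.⊗1-linear _ _ _)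

  [⊗]-zeros : ∀ {u u′ w w′} → w B.≈ᴹ B.0ᴹ → w′ B.≈ᴹ B.0ᴹ → ⟦ [ u ⊗ w ] ⟧ ≃ ⟦ [ u′ ⊗ w′ ] ⟧
  [⊗]-zeros e e′ = ≃-trans (⟦⟧.[⊗]-zero e) (≃-sym (⟦⟧.[⊗]-zero e′))

  [⊗]-zero-sum³ : ∀ {u u₁ u₂ u₃ w} → w B.≈ᴹ B.0ᴹ →
                  ⟦ [ u ⊗ w ] ⟧ ≃ (⟦ [ u₁ ⊗ B.0ᴹ ] ⟧ +T ⟦ [ u₂ ⊗ B.0ᴹ ] ⟧) +T ⟦ [ u₃ ⊗ B.0ᴹ ] ⟧
  [⊗]-zero-sum³ e = ≃-trans (⟦⟧.[⊗]-zero e) (≃-sym (≃-trans (Tᴹ.+ᴹ-zerosˡ zero zero) zero))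
    where
    zero : ∀ {u} → ⟦ [ u ⊗ B.0ᴹ ] ⟧ ≃ 0T
    zero = ⟦⟧.[⊗]-zero B.≈ᴹ-refl

  ax1-pure : ∀ P Q R → ⟦ (P ≺ᴾ Q) ≺ᴾ R ⟧ ≃ (⟦ P ≺ᴾ (Q ≺ᴾ R) ⟧ +T ⟦ P ≺ᴾ (Q ·ᴾ R) ⟧) +T ⟦ P ≺ᴾ (Q ≻ᴾ R) ⟧
  ax1-pure [ u₁ ⊗ w₁ ] [ u₂ ⊗ w₂ ] [ u₃ ⊗ w₃ ] = [⊗]-cong-sum³ (starĀ-assoc u₁ u₂ u₃)
    (B.≈ᴹ-trans (Bᵗ.ax1 w₁ w₂ w₃) (+ᴹ-homo³ (Bᴹ.linearʳ Bᵗ.≺-bilinear w₁) _ _ _))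
  ax1-pure [ u₁ ⊗ w₁ ] [ u₂ ⊗ w₂ ] [ z ⊗1]     = [⊗]-cong-sum³ (starĀ-assoc u₁ u₂ (just z))
    (B.≈ᴹ-sym (Bᴹ.+ᴹ-zerosʳ (opB-zeroʳ ≺op w₁) (opB-zeroʳ ≺op w₁)))
  ax1-pure [ u₁ ⊗ w₁ ] [ y ⊗1]     [ u₃ ⊗ w₃ ] = [⊗]-cong-sum³ (starĀ-assoc u₁ (just y) u₃)
    (B.≈ᴹ-sym (Bᴹ.+ᴹ-zerosˡ (opB-zeroʳ ≺op w₁) (opB-zeroʳ ≺op w₁)))
  ax1-pure [ u₁ ⊗ w₁ ] [ y ⊗1]     [ z ⊗1]     =
    [starĀ⊗]-cong-sum³ʳ u₁ _ _ _ w₁ (starĀ-assoc u₁ (just y) (just z))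
  ax1-pure [ x ⊗1]     [ u₂ ⊗ w₂ ] [ u₃ ⊗ w₃ ] = [⊗]-zero-sum³ (opB-zeroˡ ≺op w₃)
  ax1-pure [ x ⊗1]     [ u₂ ⊗ w₂ ] [ z ⊗1]     = [⊗]-zero-sum³ B.≈ᴹ-refl
  ax1-pure [ x ⊗1]     [ y ⊗1]     [ u₃ ⊗ w₃ ] = [⊗]-zero-sum³ B.≈ᴹ-refl
  ax1-pure [ x ⊗1]     [ y ⊗1]     [ z ⊗1]     =
    [⊗1]-cong-sum³ (A.≈ᴹ-trans (Aᵗ.ax1 x y z) (+ᴹ-homo³ (Aᴹ.linearʳ Aᵗ.≺-bilinear x) _ _ _))

  ax2-pure : ∀ P Q R → ⟦ (P ≻ᴾ Q) ≺ᴾ R ⟧ ≃ ⟦ P ≻ᴾ (Q ≺ᴾ R) ⟧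
  ax2-pure [ u₁ ⊗ w₁ ] [ u₂ ⊗ w₂ ] [ u₃ ⊗ w₃ ] = ⟦⟧.[⊗]-cong (starĀ-assoc u₁ u₂ u₃) (Bᵗ.ax2 w₁ w₂ w₃)
  ax2-pure [ u₁ ⊗ w₁ ] [ u₂ ⊗ w₂ ] [ z ⊗1]     = ⟦⟧.[⊗]-cong (starĀ-assoc u₁ u₂ (just z)) B.≈ᴹ-refl
  ax2-pure [ u₁ ⊗ w₁ ] [ y ⊗1]     [ u₃ ⊗ w₃ ] = [⊗]-zeros (opB-zeroˡ ≺op w₃) (opB-zeroʳ ≻op w₁)
  ax2-pure [ u₁ ⊗ w₁ ] [ y ⊗1]     [ z ⊗1]     = [⊗]-zeros B.≈ᴹ-refl B.≈ᴹ-refl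
  ax2-pure [ x ⊗1]     [ u₂ ⊗ w₂ ] [ u₃ ⊗ w₃ ] = ⟦⟧.[⊗]-cong (starĀ-assoc (just x) u₂ u₃) B.≈ᴹ-refl
  ax2-pure [ x ⊗1]     [ u₂ ⊗ w₂ ] [ z ⊗1]     = ⟦⟧.[⊗]-cong (starĀ-assoc (just x) u₂ (just z)) B.≈ᴹ-refl
  ax2-pure [ x ⊗1]     [ y ⊗1]     [ u₃ ⊗ w₃ ] = [⊗]-zeros B.≈ᴹ-refl B.≈ᴹ-refl
  ax2-pure [ x ⊗1]     [ y ⊗1]     [ z ⊗1]     = IsLinearMap.cong ⟦⟧.⊗1-linear (Aᵗ.ax2 x y z)

  ax3-pure : ∀ P Q R → ⟦ P ≻ᴾ (Q ≻ᴾ R) ⟧ ≃ (⟦ (P ≺ᴾ Q) ≻ᴾ R ⟧ +T ⟦ (P ·ᴾ Q) ≻ᴾ R ⟧) +T ⟦ (P ≻ᴾ Q) ≻ᴾ R ⟧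
  ax3-pure [ u₁ ⊗ w₁ ] [ u₂ ⊗ w₂ ] [ u₃ ⊗ w₃ ] = [⊗]-cong-sum³ (≈Ā-sym (starĀ-assoc u₁ u₂ u₃))
    (B.≈ᴹ-trans (B.≈ᴹ-sym (Bᵗ.ax3 w₁ w₂ w₃)) (+ᴹ-homo³ (Bᴹ.linearˡ Bᵗ.≻-bilinear w₃) _ _ _))
  ax3-pure [ u₁ ⊗ w₁ ] [ u₂ ⊗ w₂ ] [ z ⊗1]     = [⊗]-zero-sum³ (opB-zeroʳ ≻op w₁)
  ax3-pure [ u₁ ⊗ w₁ ] [ y ⊗1]     [ u₃ ⊗ w₃ ] = [⊗]-cong-sum³ (≈Ā-sym (starĀ-assoc u₁ (just y) u₃))
    (B.≈ᴹ-sym (Bᴹ.+ᴹ-zerosʳ (opB-zeroˡ ≻op w₃) (opB-zeroˡ ≻op w₃)))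
  ax3-pure [ u₁ ⊗ w₁ ] [ y ⊗1]     [ z ⊗1]     = [⊗]-zero-sum³ B.≈ᴹ-refl
  ax3-pure [ x ⊗1]     [ u₂ ⊗ w₂ ] [ u₃ ⊗ w₃ ] = [⊗]-cong-sum³ (≈Ā-sym (starĀ-assoc (just x) u₂ u₃))
    (B.≈ᴹ-sym (Bᴹ.+ᴹ-zerosˡ (opB-zeroˡ ≻op w₃) (opB-zeroˡ ≻op w₃)))
  ax3-pure [ x ⊗1]     [ u₂ ⊗ w₂ ] [ z ⊗1]     = [⊗]-zero-sum³ B.≈ᴹ-refl
  ax3-pure [ x ⊗1]     [ y ⊗1]     [ u₃ ⊗ w₃ ] =
    [starĀ⊗]-cong-sum³ˡ u₃ _ _ _ w₃ (≈Ā-sym (starĀ-assoc (just x) (just y) u₃))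
  ax3-pure [ x ⊗1]     [ y ⊗1]     [ z ⊗1]     =
    [⊗1]-cong-sum³ (A.≈ᴹ-trans (A.≈ᴹ-sym (Aᵗ.ax3 x y z)) (+ᴹ-homo³ (Aᴹ.linearˡ Aᵗ.≻-bilinear z) _ _ _))

  ax4-pure : ∀ P Q R → ⟦ (P ≻ᴾ Q) ·ᴾ R ⟧ ≃ ⟦ P ≻ᴾ (Q ·ᴾ R) ⟧
  ax4-pure [ u₁ ⊗ w₁ ] [ u₂ ⊗ w₂ ] [ u₃ ⊗ w₃ ] = ⟦⟧.[⊗]-cong (starĀ-assoc u₁ u₂ u₃) (Bᵗ.ax4 w₁ w₂ w₃)
  ax4-pure [ u₁ ⊗ w₁ ] [ u₂ ⊗ w₂ ] [ z ⊗1]     = [⊗]-zeros B.≈ᴹ-refl (opB-zeroʳ ≻op w₁)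
  ax4-pure [ u₁ ⊗ w₁ ] [ y ⊗1]     [ u₃ ⊗ w₃ ] = [⊗]-zeros (opB-zeroˡ ·op w₃) (opB-zeroʳ ≻op w₁)
  ax4-pure [ u₁ ⊗ w₁ ] [ y ⊗1]     [ z ⊗1]     = [⊗]-zeros B.≈ᴹ-refl B.≈ᴹ-refl
  ax4-pure [ x ⊗1]     [ u₂ ⊗ w₂ ] [ u₃ ⊗ w₃ ] = ⟦⟧.[⊗]-cong (starĀ-assoc (just x) u₂ u₃) B.≈ᴹ-refl
  ax4-pure [ x ⊗1]     [ u₂ ⊗ w₂ ] [ z ⊗1]     = ⟦⟧.[⊗]-cong (starĀ-assoc (just x) u₂ (just z)) B.≈ᴹ-refl
  ax4-pure [ x ⊗1]     [ y ⊗1]     [ u₃ ⊗ w₃ ] = [⊗]-zeros B.≈ᴹ-refl B.≈ᴹ-refl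
  ax4-pure [ x ⊗1]     [ y ⊗1]     [ z ⊗1]     = IsLinearMap.cong ⟦⟧.⊗1-linear (Aᵗ.ax4 x y z)

  ax5-pure : ∀ P Q R → ⟦ (P ≺ᴾ Q) ·ᴾ R ⟧ ≃ ⟦ P ·ᴾ (Q ≻ᴾ R) ⟧
  ax5-pure [ u₁ ⊗ w₁ ] [ u₂ ⊗ w₂ ] [ u₃ ⊗ w₃ ] = ⟦⟧.[⊗]-cong (starĀ-assoc u₁ u₂ u₃) (Bᵗ.ax5 w₁ w₂ w₃)
  ax5-pure [ u₁ ⊗ w₁ ] [ u₂ ⊗ w₂ ] [ z ⊗1]     = [⊗]-zeros B.≈ᴹ-refl (opB-zeroʳ ·op w₁)
  ax5-pure [ u₁ ⊗ w₁ ] [ y ⊗1]     [ u₃ ⊗ w₃ ] = ⟦⟧.[⊗]-cong (starĀ-assoc u₁ (just y) u₃) B.≈ᴹ-refl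
  ax5-pure [ u₁ ⊗ w₁ ] [ y ⊗1]     [ z ⊗1]     = [⊗]-zeros B.≈ᴹ-refl B.≈ᴹ-refl
  ax5-pure [ x ⊗1]     [ u₂ ⊗ w₂ ] [ u₃ ⊗ w₃ ] = [⊗]-zeros (opB-zeroˡ ·op w₃) B.≈ᴹ-refl
  ax5-pure [ x ⊗1]     [ u₂ ⊗ w₂ ] [ z ⊗1]     = [⊗]-zeros B.≈ᴹ-refl B.≈ᴹ-refl
  ax5-pure [ x ⊗1]     [ y ⊗1]     [ u₃ ⊗ w₃ ] = [⊗]-zeros B.≈ᴹ-refl B.≈ᴹ-refl
  ax5-pure [ x ⊗1]     [ y ⊗1]     [ z ⊗1]     = IsLinearMap.cong ⟦⟧.⊗1-linear (Aᵗ.ax5 x y z)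

  ax6-pure : ∀ P Q R → ⟦ (P ·ᴾ Q) ≺ᴾ R ⟧ ≃ ⟦ P ·ᴾ (Q ≺ᴾ R) ⟧
  ax6-pure [ u₁ ⊗ w₁ ] [ u₂ ⊗ w₂ ] [ u₃ ⊗ w₃ ] = ⟦⟧.[⊗]-cong (starĀ-assoc u₁ u₂ u₃) (Bᵗ.ax6 w₁ w₂ w₃)
  ax6-pure [ u₁ ⊗ w₁ ] [ u₂ ⊗ w₂ ] [ z ⊗1]     = ⟦⟧.[⊗]-cong (starĀ-assoc u₁ u₂ (just z)) B.≈ᴹ-refl
  ax6-pure [ u₁ ⊗ w₁ ] [ y ⊗1]     [ u₃ ⊗ w₃ ] = [⊗]-zeros (opB-zeroˡ ≺op w₃) (opB-zeroʳ ·op w₁)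
  ax6-pure [ u₁ ⊗ w₁ ] [ y ⊗1]     [ z ⊗1]     = [⊗]-zeros B.≈ᴹ-refl B.≈ᴹ-refl
  ax6-pure [ x ⊗1]     [ u₂ ⊗ w₂ ] [ u₃ ⊗ w₃ ] = [⊗]-zeros (opB-zeroˡ ≺op w₃) B.≈ᴹ-refl
  ax6-pure [ x ⊗1]     [ u₂ ⊗ w₂ ] [ z ⊗1]     = [⊗]-zeros B.≈ᴹ-refl B.≈ᴹ-refl
  ax6-pure [ x ⊗1]     [ y ⊗1]     [ u₃ ⊗ w₃ ] = [⊗]-zeros B.≈ᴹ-refl B.≈ᴹ-refl
  ax6-pure [ x ⊗1]     [ y ⊗1]     [ z ⊗1]     = IsLinearMap.cong ⟦⟧.⊗1-linear (Aᵗ.ax6 x y z)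

  ax7-pure : ∀ P Q R → ⟦ (P ·ᴾ Q) ·ᴾ R ⟧ ≃ ⟦ P ·ᴾ (Q ·ᴾ R) ⟧
  ax7-pure [ u₁ ⊗ w₁ ] [ u₂ ⊗ w₂ ] [ u₃ ⊗ w₃ ] = ⟦⟧.[⊗]-cong (starĀ-assoc u₁ u₂ u₃) (Bᵗ.ax7 w₁ w₂ w₃)
  ax7-pure [ u₁ ⊗ w₁ ] [ u₂ ⊗ w₂ ] [ z ⊗1]     = [⊗]-zeros B.≈ᴹ-refl (opB-zeroʳ ·op w₁)
  ax7-pure [ u₁ ⊗ w₁ ] [ y ⊗1]     [ u₃ ⊗ w₃ ] = [⊗]-zeros (opB-zeroˡ ·op w₃) (opB-zeroʳ ·op w₁)
  ax7-pure [ u₁ ⊗ w₁ ] [ y ⊗1]     [ z ⊗1]     = [⊗]-zeros B.≈ᴹ-refl B.≈ᴹ-refl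
  ax7-pure [ x ⊗1]     [ u₂ ⊗ w₂ ] [ u₃ ⊗ w₃ ] = [⊗]-zeros (opB-zeroˡ ·op w₃) B.≈ᴹ-refl
  ax7-pure [ x ⊗1]     [ u₂ ⊗ w₂ ] [ z ⊗1]     = [⊗]-zeros B.≈ᴹ-refl B.≈ᴹ-refl
  ax7-pure [ x ⊗1]     [ y ⊗1]     [ u₃ ⊗ w₃ ] = [⊗]-zeros B.≈ᴹ-refl B.≈ᴹ-refl
  ax7-pure [ x ⊗1]     [ y ⊗1]     [ z ⊗1]     = IsLinearMap.cong ⟦⟧.⊗1-linear (Aᵗ.ax7 x y z)

  isTridendriform : IsTridendriform R _≃_ _+T_ _•T_ _≺T_ _·T_ _≻T_
  isTridendriform = record
    { ≺-bilinear = mulT-bilinear ≺op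
    ; ·-bilinear = mulT-bilinear ·op
    ; ≻-bilinear = mulT-bilinear ≻op
    ; ax1 = from-pure (nestedˡ ≺op ≺op) (Tᴹ.nestedʳ-trilinear (mulT-bilinear ≺op) *T-bilinear)
              (mulT-⟦⟧-nestedˡ ≺op ≺op) (mulT-⟦⟧-*ʳ ≺op) ax1-pure
    ; ax2 = from-pure (nestedˡ ≺op ≻op) (nestedʳ ≻op ≺op)
              (mulT-⟦⟧-nestedˡ ≺op ≻op) (mulT-⟦⟧-nestedʳ ≻op ≺op) ax2-pure
    ; ax3 = from-pure (Tᴹ.nestedˡ-trilinear *T-bilinear (mulT-bilinear ≻op)) (nestedʳ ≻op ≻op)
              (mulT-⟦⟧-*ˡ ≻op) (mulT-⟦⟧-nestedʳ ≻op ≻op) (λ P Q R → ≃-sym (ax3-pure P Q R))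
    ; ax4 = from-pure (nestedˡ ·op ≻op) (nestedʳ ≻op ·op)
              (mulT-⟦⟧-nestedˡ ·op ≻op) (mulT-⟦⟧-nestedʳ ≻op ·op) ax4-pure
    ; ax5 = from-pure (nestedˡ ·op ≺op) (nestedʳ ·op ≻op)
              (mulT-⟦⟧-nestedˡ ·op ≺op) (mulT-⟦⟧-nestedʳ ·op ≻op) ax5-pure
    ; ax6 = from-pure (nestedˡ ≺op ·op) (nestedʳ ·op ≺op)
              (mulT-⟦⟧-nestedˡ ≺op ·op) (mulT-⟦⟧-nestedʳ ·op ≺op) ax6-pure
    ; ax7 = from-pure (nestedˡ ·op ·op) (nestedʳ ·op ·op)
              (mulT-⟦⟧-nestedˡ ·op ·op) (mulT-⟦⟧-nestedʳ ·op ·op) ax7-pure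
    }
    where
    nestedˡ : ∀ o o′ → Tᴹ.IsTrilinear (λ x y z → mulT o (mulT o′ x y) z)
    nestedˡ o o′ = Tᴹ.nestedˡ-trilinear (mulT-bilinear o′) (mulT-bilinear o)

    nestedʳ : ∀ o o′ → Tᴹ.IsTrilinear (λ x y z → mulT o x (mulT o′ y z))
    nestedʳ o o′ = Tᴹ.nestedʳ-trilinear (mulT-bilinear o) (mulT-bilinear o′)

    from-pure : ∀ {F H} → Tᴹ.IsTrilinear F → Tᴹ.IsTrilinear H → {l r : Pure → Pure → Pure → Term} →
                (∀ P Q R → F ⟦ P ⟧ ⟦ Q ⟧ ⟦ R ⟧ ≡ l P Q R) → (∀ P Q R → H ⟦ P ⟧ ⟦ Q ⟧ ⟦ R ⟧ ≡ r P Q R) →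
                (∀ P Q R → l P Q R ≃ r P Q R) → ∀ x y z → F x y z ≃ H x y z
    from-pure F-trilinear H-trilinear F≡l H≡r l≃r = trilinear-ext F-trilinear H-trilinear λ P Q R →
      ≡.subst₂ _≃_ (≡.sym (F≡l P Q R)) (≡.sym (H≡r P Q R)) (l≃r P Q R)

  *T-gen : ∀ p q → gen p *T gen q ≃ tensor (starĀ (fstPT p) (fstPT q)) (starB̄ (sndPT p) (sndPT q))
  *T-gen (x ⊗ y) (c ⊗ d) = ≃-sym ([⊗]-sum³ (just (x A.* c)) _ _ _)
  *T-gen (x ⊗ y) (1⊗ d)  = ≃-sym ([⊗]-sum³ (just x) _ _ _)
  *T-gen (x ⊗ y) (c ⊗1)  = ≃-sym ([⊗]-cong-sum³ ≈Ā-refl (B.≈ᴹ-sym (Bᴹ.+ᴹ-zerosʳ B.≈ᴹ-refl B.≈ᴹ-refl)))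
  *T-gen (1⊗ y)  (c ⊗ d) = ≃-sym ([⊗]-sum³ (just c) _ _ _)
  *T-gen (1⊗ y)  (1⊗ d)  = ≃-sym ([⊗]-sum³ nothing _ _ _)
  *T-gen (1⊗ y)  (c ⊗1)  = ≃-sym ([⊗]-cong-sum³ ≈Ā-refl (B.≈ᴹ-sym (Bᴹ.+ᴹ-zerosʳ B.≈ᴹ-refl B.≈ᴹ-refl)))
  *T-gen (x ⊗1)  (c ⊗ d) = ≃-sym ([⊗]-cong-sum³ ≈Ā-refl (B.≈ᴹ-sym (Bᴹ.+ᴹ-zerosˡ B.≈ᴹ-refl B.≈ᴹ-refl)))
  *T-gen (x ⊗1)  (1⊗ d)  = ≃-sym ([⊗]-cong-sum³ ≈Ā-refl (B.≈ᴹ-sym (Bᴹ.+ᴹ-zerosˡ B.≈ᴹ-refl B.≈ᴹ-refl)))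
  *T-gen (x ⊗1)  (c ⊗1)  = ≃-sym (+ᴹ-homo³ ⟦⟧.⊗1-linear _ _ _)

mainTheorem3 : ∀ {k ℓk a ℓa b ℓb} (K : Field k ℓk)
    (A : TridendriformAlgebra (Field.commutativeRing K) a ℓa)
    (B : TridendriformAlgebra (Field.commutativeRing K) b ℓb) →
    let open TensorConstruction K A B in
    IsModule R _≃_ _+T_ 0T -T_ _•T_ _•ᵣT_
    × IsTridendriform R _≃_ _+T_ _•T_ _≺T_ _·T_ _≻T_
    × (∀ p q → gen p *T gen q ≃ tensor (starĀ (fstPT p) (fstPT q)) (starB̄ (sndPT p) (sndPT q)))
mainTheorem3 K A B = isModule , isTridendriform , *T-gen
  where open TensorProperties K A B
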